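{- Let $G$ be a finite simple connected graph with weight function $\omega:E(G)\to\{1,2,3,\dots\}$ and $x\in V(G)$. If $p\in\mathcal{B}_{i+1}(G_\omega,x)$ for some integer $i\ge0$, then $p=q_{r^{ -1}}$ for some $q\in\mathcal{B}_i(G_\omega,x)$ and some pebbling move $r$.
   Context: A pebble distribution is a function $p:V(G)\to\mathbb{Z}_{\ge0}$; $q<p$ means $q(v)\le p(v)$ for all $v$ and $q\ne p$. For an edge $vu$, the pebbling move $(v\to u)$ transforms $p$ into $p_{(v\to u)}$ with $p_{(v\to u)}(v)=p(v)-\omega(vu)$, $p_{(v\to u)}(u)=p(u)+1$, other values unchanged; its inverse $(v\to u)^{ -1}$ transforms $p$ into $p_{(v\to u)^{ -1}}$ with $p_{(v\to u)^{ -1}}(v)=p(v)+\omega(vu)$, $p_{(v\to u)^{ -1}}(u)=p(u)-1$, other values unchanged. A sequence of moves is executable from $p$ if no vertex ever has a negative number of pebbles; $x$ is reachable from $p$ if some sequence executable from $p$ puts at least one pebble on $x$. $\mathcal{B}(G_\omega,x)$ is the set of distributions $p$ from which $x$ is reachable but from no distribution $q<p$ is $x$ reachable. For $i\ge0$, $\mathcal{B}_i(G_\omega,x)$ is the set of $p\in\mathcal{B}(G_\omega,x)$ from which $x$ is reachable by an executable sequence of $i$ moves but not by any executable sequence of fewer than $i$ moves. -}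

module Defs where

open import Data.Nat using (ℕ; zero; suc; _+_; _≤_; _<_)
open import Data.Fin using (Fin)
open import Data.List using (List; []; _∷_; length)
open import Data.Product using (Σ; ∃; _×_; _,_)
open import Relation.Binary.PropositionalEquality using (_≡_; _≢_)
open import Relation.Nullary using (¬_)

record SimpleGraph (n : ℕ) : Set₁ where
  field
    Adj     : Fin n → Fin n → Set
    symm    : ∀ {u v} → Adj u v → Adj v u
    irrefl  : ∀ {v} → ¬ Adj v v
open SimpleGraph public

data Walk {n : ℕ} (G : SimpleGraph n) : Fin n → Fin n → Set where
  nil  : ∀ {v} → Walk G v v
  cons : ∀ {u v w} → Adj G u v → Walk G v w → Walk G u w

Connected : ∀ {n} → SimpleGraph n → Set
Connected G = ∀ u v → Walk G u v

-- A weight function ω : E(G) → {1,2,3,...}; an edge is unordered, so ω is symmetric.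
-- Values of ω on non-edges are irrelevant.
record Weight {n : ℕ} (G : SimpleGraph n) : Set where
  field
    ω     : Fin n → Fin n → ℕ
    ω-sym : ∀ u v → Adj G u v → ω u v ≡ ω v u
    ω-pos : ∀ u v → Adj G u v → 1 ≤ ω u v
open Weight public

Distribution : ℕ → Set
Distribution n = Fin n → ℕ

_<D_ : ∀ {n} → Distribution n → Distribution n → Set
q <D p = (∀ v → q v ≤ p v) × ¬ (∀ v → q v ≡ p v)

-- A pebbling move (v → u): ordered pair of vertices (must be an edge to be applied).
record Move (n : ℕ) : Set where
  constructor _⇒_
  field
    src : Fin n
    tgt : Fin n
open Move public

module _ {n : ℕ} (G : SimpleGraph n) (W : Weight G) where

  -- Step p r p' : r = (v → u) is a pebbling move along an edge vu, executable from p
  -- (no negative values), and p' = p_{(v→u)}.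
  Step : Distribution n → Move n → Distribution n → Set
  Step p (v ⇒ u) p' =
    Adj G v u ×
    (p' v + ω W v u ≡ p v) ×
    (p' u ≡ suc (p u)) ×
    (∀ w → w ≢ v → w ≢ u → p' w ≡ p w)

  -- InvMove q r p : r = (v → u) is a pebbling move along an edge vu and p = q_{(v→u)^{-1}}
  -- (p is a distribution, i.e. nonnegative).
  InvMove : Distribution n → Move n → Distribution n → Set
  InvMove q (v ⇒ u) p =
    Adj G v u ×
    (p v ≡ q v + ω W v u) ×
    (suc (p u) ≡ q u) ×
    (∀ w → w ≢ v → w ≢ u → p w ≡ q w)

  data Exec : Distribution n → List (Move n) → Distribution n → Set where
    done : ∀ {p} → Exec p [] p
    step : ∀ {p r p' rs p''} → Step p r p' → Exec p' rs p'' → Exec p (r ∷ rs) p''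

  ReachableIn : Fin n → ℕ → Distribution n → Set
  ReachableIn x k p =
    Σ (List (Move n)) λ rs → Σ (Distribution n) λ p' →
      (length rs ≡ k) × Exec p rs p' × (1 ≤ p' x)

  Reachable : Fin n → Distribution n → Set
  Reachable x p = Σ ℕ λ k → ReachableIn x k p

  InB : Fin n → Distribution n → Set
  InB x p = Reachable x p × (∀ q → q <D p → ¬ Reachable x q)

  InBi : Fin n → ℕ → Distribution n → Set
  InBi x i p = InB x p × ReachableIn x i p × (∀ j → j < i → ¬ ReachableIn x j p)

-- Take an optimal sequence of i+1 moves from p and let q be the result of its
-- first move r = (v → u), so that p = q_{r⁻¹}. The remaining i moves reach x
-- from q, and fewer would give a sequence shorter than i+1 from p. For
-- minimality, let q' < q reach x. If q' has no pebble on u then already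
-- q' < p, because q'(v) ≤ q(v) < p(v). Otherwise undoing r on q' yields a
-- distribution p' < p from which r followed by a sequence for q' reaches x.
-- Either way the minimality of p is contradicted.
module Submission where

open import Defs
open import Data.Nat using (ℕ; suc; zero; pred; _+_; _≤_; _<_; z≤n; s≤s; s≤s⁻¹)
open import Data.Nat.Properties
  using (≤-reflexive; ≤-antisym; ≤-<-trans; <⇒≤; <-irrefl; m<m+n; +-cancelʳ-≤; +-monoˡ-≤)
open import Data.Fin using (Fin; _≟_)
open import Data.Vec.Functional using (updateAt)
open import Data.Vec.Functional.Properties using (updateAt-updates; updateAt-minimal)
open import Data.Product using (Σ; _×_; _,_)
open import Data.List using (_∷_)
open import Function using (_∘_)
open import Relation.Binary.PropositionalEquality
  using (_≡_; _≢_; refl; sym; trans; cong; subst; subst₂; module ≡-Reasoning)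
open import Relation.Nullary using (¬_; yes; no)

data Position {n : ℕ} (v u : Fin n) : Fin n → Set where
  at-src    : Position v u v
  at-tgt    : Position v u u
  elsewhere : ∀ {w} → w ≢ v → w ≢ u → Position v u w

position : ∀ {n} (v u w : Fin n) → Position v u w
position v u w with w ≟ v | w ≟ u
... | yes refl | _        = at-src
... | no _     | yes refl = at-tgt
... | no w≢v   | no w≢u   = elsewhere w≢v w≢u

unmove : ∀ {n} → Distribution n → Fin n → Fin n → ℕ → Distribution n
unmove q v u k = updateAt (updateAt q u pred) v (_+ k)

module _ {n : ℕ} {v u : Fin n} (q : Distribution n) (k : ℕ) where

  unmove-src : v ≢ u → unmove q v u k v ≡ q v + k
  unmove-src v≢u = trans (updateAt-updates v _) (cong (_+ k) (updateAt-minimal v u q v≢u))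

  unmove-tgt : v ≢ u → unmove q v u k u ≡ pred (q u)
  unmove-tgt v≢u = trans (updateAt-minimal u v _ (v≢u ∘ sym)) (updateAt-updates u q)

  unmove-other : ∀ {w} → w ≢ v → w ≢ u → unmove q v u k w ≡ q w
  unmove-other w≢v w≢u = trans (updateAt-minimal _ v _ w≢v) (updateAt-minimal _ u q w≢u)

module _ {n : ℕ} {G : SimpleGraph n} {W : Weight G} where

  Minimal : Fin n → Distribution n → Set
  Minimal x p = ∀ q → q <D p → ¬ Reachable G W x q

  Adj⇒≢ : ∀ {v u} → Adj G v u → v ≢ u
  Adj⇒≢ vu refl = irrefl G vu

  Step⇒InvMove : ∀ {p r q} → Step G W p r q → InvMove G W q r p
  Step⇒InvMove {r = _ ⇒ _} (vu , src , tgt , other) =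
    vu , sym src , sym tgt , λ w w≢v w≢u → sym (other w w≢v w≢u)

  ReachableIn-step : ∀ {x j p r q} → Step G W p r q →
    ReachableIn G W x j q → ReachableIn G W x (suc j) p
  ReachableIn-step st (rs , p' , len , ex , hit) =
    _ ∷ rs , p' , cong suc len , step st ex , hit

  Reachable-step : ∀ {x p r q} → Step G W p r q → Reachable G W x q → Reachable G W x p
  Reachable-step st (j , reach) = suc j , ReachableIn-step st reach

  ReachableIn-suc⁻¹ : ∀ {x i p} → ReachableIn G W x (suc i) p →
    Σ (Distribution n) λ q → Σ (Move n) λ r → Step G W p r q × ReachableIn G W x i q
  ReachableIn-suc⁻¹ (r ∷ rs , p' , len , step st ex , hit) =
    _ , r , st , rs , p' , cong pred len , ex , hit

  Step-mono-≤ : ∀ {p p' r q q'} → Step G W p r q → Step G W p' r q' →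
    (∀ w → p w ≤ p' w) → ∀ w → q w ≤ q' w
  Step-mono-≤ {r = v ⇒ u} (_ , src , tgt , other) (_ , src' , tgt' , other') p≤p' w
    with position v u w
  ... | at-src = +-cancelʳ-≤ (ω W v u) _ _ (subst₂ _≤_ (sym src) (sym src') (p≤p' v))
  ... | at-tgt = subst₂ _≤_ (sym tgt) (sym tgt') (s≤s (p≤p' u))
  ... | elsewhere w≢v w≢u =
    subst₂ _≤_ (sym (other w w≢v w≢u)) (sym (other' w w≢v w≢u)) (p≤p' w)

  Step-reflects-≤ : ∀ {p p' r q q'} → Step G W p r q → Step G W p' r q' →
    (∀ w → q w ≤ q' w) → ∀ w → p w ≤ p' w
  Step-reflects-≤ {r = v ⇒ u} (_ , src , tgt , other) (_ , src' , tgt' , other') q≤q' w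
    with position v u w
  ... | at-src = subst₂ _≤_ src src' (+-monoˡ-≤ (ω W v u) (q≤q' v))
  ... | at-tgt = s≤s⁻¹ (subst₂ _≤_ tgt tgt' (q≤q' u))
  ... | elsewhere w≢v w≢u = subst₂ _≤_ (other w w≢v w≢u) (other' w w≢v w≢u) (q≤q' w)

  Step-reflects-<D : ∀ {p p' r q q'} → Step G W p r q → Step G W p' r q' →
    q' <D q → p' <D p
  Step-reflects-<D st st' (q'≤q , q'≢q) =
    Step-reflects-≤ st' st q'≤q ,
    λ p'≡p → q'≢q λ w →
      ≤-antisym (q'≤q w) (Step-mono-≤ st st' (λ w′ → ≤-reflexive (sym (p'≡p w′))) w)

  Step-src-< : ∀ {p v u q} → Step G W p (v ⇒ u) q → q v < p v
  Step-src-< {v = v} {u} {q} (vu , src , _) = subst (q v <_) src (m<m+n (q v) (ω-pos W v u vu))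

  Step-<D-if-tgt-empty : ∀ {p v u q q'} → Step G W p (v ⇒ u) q →
    q' <D q → q' u ≡ 0 → q' <D p
  Step-<D-if-tgt-empty {v = v} {u} {q' = q'} st@(_ , _ , _ , other) (q'≤q , _) q'u≡0 =
    q'≤p , λ q'≡p → <-irrefl (q'≡p v) q'v<pv
    where
    q'v<pv : q' v < _
    q'v<pv = ≤-<-trans (q'≤q v) (Step-src-< st)

    q'≤p : ∀ w → q' w ≤ _
    q'≤p w with position v u w
    ... | at-src = <⇒≤ q'v<pv
    ... | at-tgt = subst (_≤ _) (sym q'u≡0) z≤n
    ... | elsewhere w≢v w≢u = subst (q' w ≤_) (other w w≢v w≢u) (q'≤q w)

  Step-unmove : ∀ {v u q c} → Adj G v u → q u ≡ suc c →
    Step G W (unmove q v u (ω W v u)) (v ⇒ u) q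
  Step-unmove {v} {u} {q} {c} vu qu≡1+c =
    vu ,
    sym (unmove-src q k v≢u) ,
    (begin
      q u                         ≡⟨ qu≡1+c ⟩
      suc c                       ≡⟨ cong (suc ∘ pred) (sym qu≡1+c) ⟩
      suc (pred (q u))            ≡⟨ cong suc (sym (unmove-tgt q k v≢u)) ⟩
      suc (unmove q v u k u)      ∎) ,
    λ w w≢v w≢u → sym (unmove-other q k w≢v w≢u)
    where
    open ≡-Reasoning
    k : ℕ
    k = ω W v u
    v≢u : v ≢ u
    v≢u = Adj⇒≢ vu

  Minimal-step : ∀ {x p r q} → Step G W p r q → Minimal x p → Minimal x q
  Minimal-step {r = v ⇒ u} st@(vu , _) minP q' q'<q reach with q' u in q'u
  ... | zero  = minP q' (Step-<D-if-tgt-empty st q'<q q'u) reach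
  ... | suc _ = minP _ (Step-reflects-<D st st' q'<q) (Reachable-step st' reach)
    where
    st' : Step G W (unmove q' v u (ω W v u)) (v ⇒ u) q'
    st' = Step-unmove vu q'u

proposition8p1 : (n : ℕ) (G : SimpleGraph n) (W : Weight G) → Connected G →
    (x : Fin n) (p : Distribution n) (i : ℕ) → InBi G W x (suc i) p →
    Σ (Distribution n) λ q → Σ (Move n) λ r →
      InBi G W x i q × InvMove G W q r p
proposition8p1 n G W _ x p i ((_ , minP) , reachP , noFaster)
  with ReachableIn-suc⁻¹ reachP
... | q , r , st , reachQ =
  q , r , (((i , reachQ) , Minimal-step st minP) , reachQ , noFasterQ) , Step⇒InvMove {W = W} st
  where
  noFasterQ : ∀ j → j < i → ¬ ReachableIn G W x j q
  noFasterQ j j<i reach = noFaster (suc j) (s≤s j<i) (ReachableIn-step st reach)
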